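{- Let $\mathcal{U}$ be a finite set of objects equipped with a symmetric relation called "being $t$-intersecting", and use the terminology below. Let $N_0$ be the size of the extremal $t$-intersecting families, let $N_1$ be the largest size of a maximal $t$-intersecting family that is not extremal (with $N_1=0$ if there is no such family), let $N_2$ be such that any two distinct extremal $t$-intersecting families have at most $N_2$ members in common, and let $M$ be such that there are at most $M$ maximal $t$-intersecting families. Suppose \[ N_0 - \max(N_1,N_2) - \frac{6\log_2 M}{2\log_2 3 - 3} > 0. \] Then every family $\mathcal{F}\subseteq\mathcal{U}$ has at most $3^{N_0}$ $(3,t)$-colourings, with equality if and only if $\mathcal{F}$ is an extremal $t$-intersecting family.
   Context: In the intended applications, $\mathcal{U}$ is the set of $k$-subsets of $[n]$ (two sets are $t$-intersecting if they share at least $t$ elements), the set of $k$-dimensional subspaces of $\mathbb{F}_q^n$ (two subspaces are $t$-intersecting if their intersection has dimension at least $t$), or the symmetric group $S_n$ (two permutations are $t$-intersecting if they agree on at least $t$ indices). A family $\mathcal{F}\subseteq\mathcal{U}$ is $t$-intersecting if every two distinct members of $\mathcal{F}$ are $t$-intersecting. A $t$-intersecting family is maximal if it is not properly contained in another $t$-intersecting family $\mathcal{G}\subseteq\mathcal{U}$. A $t$-intersecting family is extremal if it has the maximum possible size among all $t$-intersecting families in $\mathcal{U}$. For an integer $r\ge1$, an $(r,t)$-colouring of a family $\mathcal{F}$ is a map $\mathcal{F}\to\{1,\dots,r\}$ such that every colour class is a $t$-intersecting family. -}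

module Defs where

open import Data.Nat using (ℕ; _≤_)
open import Data.Bool using (Bool)
open import Data.Fin using (Fin; zero)
open import Data.Fin.Properties using (_≟_)
open import Data.Fin.Subset using (Subset; _∈_; _∉_; _⊆_; _∩_; ∣_∣)
open import Data.Vec using (Vec; lookup; tabulate)
open import Data.List using (List; length)
open import Data.List.Relation.Unary.All using (All)
open import Data.List.Relation.Unary.Unique.Propositional using (Unique)
open import Data.Product using (Σ; _×_)
open import Relation.Nullary using (¬_; does)
open import Relation.Binary.PropositionalEquality using (_≡_; _≢_)

AtMost : ∀ {A : Set} → (A → Set) → ℕ → Set
AtMost {A} P k = (L : List A) → Unique L → All P L → length L ≤ k

AtLeast : ∀ {A : Set} → (A → Set) → ℕ → Set
AtLeast {A} P k = Σ (List A) λ L → Unique L × All P L × k ≤ length L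

module _ {n : ℕ} (R : Fin n → Fin n → Set) where

  -- U = Fin n, R = "being t-intersecting"; families are subsets of U.
  Intersecting : Subset n → Set
  Intersecting F = ∀ x y → x ∈ F → y ∈ F → x ≢ y → R x y

  Maximal : Subset n → Set
  Maximal F = Intersecting F × (∀ G → Intersecting G → F ⊆ G → G ⊆ F)

  Extremal : Subset n → Set
  Extremal F = Intersecting F × (∀ G → Intersecting G → ∣ G ∣ ≤ ∣ F ∣)

  -- A map F → {1,2,3} is encoded as c : Vec (Fin 3) n, normalised to colour
  -- zero outside F (so colourings of F correspond bijectively to such c).
  colourClass : Subset n → Vec (Fin 3) n → Fin 3 → Subset n
  colourClass F c i = F ∩ tabulate (λ x → does (lookup c x ≟ i))

  IsColouring : Subset n → Vec (Fin 3) n → Set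
  IsColouring F c =
    (∀ x → x ∉ F → lookup c x ≡ zero) × (∀ i → Intersecting (colourClass F c i))

-- An intersecting family admits every map F → {1,2,3} as a colouring, so it has 3^|F| ≤ 3^N₀
-- colourings, with equality exactly when F is extremal. For a non-intersecting F, extend the three
-- colour classes of a colouring to maximal families A, B, C; the colouring is then a choice, at each
-- x ∈ F, of a colour whose family contains x. A pointwise count bounds the number P of such choices
-- by P² · 8^|A∩B∩C| ≤ 9^|A∩B∩C| · 2^(|A|+|B|+|C|) ≤ 9^|A∩B∩C| · 8^N₀. If A = B = C then P = 0, as
-- F ⊆ A would make F intersecting; otherwise two of the families differ and |A∩B∩C| ≤ K = max(N₁, N₂).
-- With at most M³ triples the number T of colourings satisfies T² · 8^K ≤ M⁶ · 9^K · 8^N₀, which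
-- together with 8^(N₀-K) · M⁶ < 9^(N₀-K) forces T < 3^N₀.
module Submission where

open import Defs
open import Data.Bool using (Bool; true; false; _∧_)
open import Data.Bool.Properties using () renaming (_≟_ to _≟ᵇ_)
open import Data.Fin using (Fin; zero; suc)
open import Data.Fin.Properties using (_≟_; all?)
open import Data.Fin.Subset using (Subset; _∩_; ∣_∣; _∈_; _∉_; _⊆_; inside; outside)
open import Data.Fin.Subset.Properties
  using (_∈?_; _⊆?_; ⊆-refl; ⊆-trans; p⊂q⇒∣p∣<∣q∣; p⊆q⇒∣p∣≤∣q∣; p∩q⊆p; x∈p∩q⁺; x∈p∩q⁻; ∣p∩q∣≤∣p∣; ∣p∩q∣≤∣q∣)
open import Data.List using (List; []; _∷_; length; _++_; map; filter; concatMap; cartesianProductWith; cartesianProduct)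
open import Data.List.Extrema.Nat using (argmax; argmax-all; f[xs]≤f[argmax]; max; xs≤max)
open import Data.List.Membership.Propositional using (_─_; lose) renaming (_∈_ to _∈ₗ_; _∉_ to _∉ₗ_)
open import Data.List.Membership.Propositional.Properties
  using (∈-cartesianProductWith⁺; ∈-cartesianProductWith⁻; ∈-cartesianProduct⁺; ∈-cartesianProduct⁻;
         ∈-filter⁺; ∈-filter⁻; ∈-concatMap⁺)
open import Data.List.Properties using (length-++; length-map; length-removeAt′)
open import Data.List.Relation.Binary.Subset.Propositional using () renaming (_⊆_ to _⊆ₗ_)
open import Data.List.Relation.Unary.All as All using (All)
open import Data.List.Relation.Unary.All.Properties using (all-filter; map⁺; map⁻)
open import Data.List.Relation.Unary.Any using (here; there; index)
open import Data.List.Relation.Unary.AllPairs using ([]; _∷_)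
open import Data.List.Relation.Unary.Unique.Propositional using (Unique)
open import Data.List.Relation.Unary.Unique.Propositional.Properties using (cartesianProductWith⁺; filter⁺)
open import Data.Nat using (ℕ; zero; suc; _+_; _*_; _^_; _∸_; _⊔_; _≤_; _<_; _≤?_; z≤n; s≤s; >-nonZero)
open import Data.Nat.Properties
  using (module ≤-Reasoning; ≤-refl; ≤-reflexive; ≤-trans; ≤-antisym; <⇒≤; <⇒≱; ≰⇒>; ≮⇒≥; ≤ᵇ⇒≤;
         +-identityʳ; +-mono-≤; *-assoc; *-mono-≤; *-monoˡ-≤; *-monoʳ-≤; *-mono-<; *-cancelʳ-≤;
         [m*n]*[o*p]≡[m*o]*[n*p]; m≤m⊔n; m≤n⊔m; m+[n∸m]≡n; m∸n+n≡m;
         ^-distribˡ-+-*; ^-*-assoc; ^-monoˡ-≤; ^-monoʳ-≤; ^-monoʳ-<; m^n>0)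
open import Data.Nat.Tactic.RingSolver using (solve-∀)
open import Data.Product using (Σ; _×_; _,_; proj₁; proj₂)
open import Data.Sum using (_⊎_)
open import Data.Vec using (Vec; []; _∷_; lookup; tabulate; replicate)
open import Data.Vec.Properties using (∷-injective; lookup-replicate; lookup∘tabulate; lookup⇒[]=; []=⇒lookup; ≡-dec)
open import Function using (_∘_; id)
open import Function.Bundles using (_⇔_; mk⇔)
open import Relation.Nullary using (¬_; Dec; yes; no; contradiction)
open import Relation.Nullary.Decidable using (_×-dec_; _→-dec_; ¬?; dec-true)
open import Relation.Unary using (Decidable)
open import Relation.Binary.PropositionalEquality

private
  variable
    A B : Set
    n : ℕ

∈-─⁺ : ∀ {x z : A} {xs} (x∈xs : x ∈ₗ xs) → z ∈ₗ xs → z ≢ x → z ∈ₗ xs ─ x∈xs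
∈-─⁺ (here refl) (here refl) z≢x = contradiction refl z≢x
∈-─⁺ (here refl) (there z∈xs) _ = z∈xs
∈-─⁺ (there x∈xs) (here refl) _ = here refl
∈-─⁺ (there x∈xs) (there z∈xs) z≢x = there (∈-─⁺ x∈xs z∈xs z≢x)

Unique∧⊆⇒length≤ : ∀ {xs ys : List A} → Unique xs → xs ⊆ₗ ys → length xs ≤ length ys
Unique∧⊆⇒length≤ {xs = []} _ _ = z≤n
Unique∧⊆⇒length≤ {xs = x ∷ xs} {ys} (x∉xs ∷ xs!) xs⊆ys = begin
  suc (length xs)            ≤⟨ s≤s (Unique∧⊆⇒length≤ xs! xs⊆ys─x) ⟩
  suc (length (ys ─ x∈ys))   ≡⟨ length-removeAt′ ys (index x∈ys) ⟨
  length ys                  ∎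
  where
  open ≤-Reasoning
  x∈ys = xs⊆ys (here refl)
  xs⊆ys─x : xs ⊆ₗ ys ─ x∈ys
  xs⊆ys─x z∈xs = ∈-─⁺ x∈ys (xs⊆ys (there z∈xs)) (λ z≡x → All.lookup x∉xs z∈xs (sym z≡x))

length-cartesianProductWith : ∀ {C : Set} (f : A → B → C) xs ys →
  length (cartesianProductWith f xs ys) ≡ length xs * length ys
length-cartesianProductWith f [] ys = refl
length-cartesianProductWith f (x ∷ xs) ys = begin
  length (map (f x) ys ++ cartesianProductWith f xs ys)         ≡⟨ length-++ (map (f x) ys) ⟩
  length (map (f x) ys) + length (cartesianProductWith f xs ys) ≡⟨ cong₂ _+_ (length-map (f x) ys)
                                                                    (length-cartesianProductWith f xs ys) ⟩
  length ys + length xs * length ys                             ∎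
  where open ≡-Reasoning

length-concatMap≤ : ∀ (f : A → List B) {b} xs → All (λ x → length (f x) ≤ b) xs →
  length (concatMap f xs) ≤ length xs * b
length-concatMap≤ f [] _ = z≤n
length-concatMap≤ f (x ∷ xs) (fx≤b All.∷ fxs≤b) = begin
  length (f x ++ concatMap f xs)         ≡⟨ length-++ (f x) ⟩
  length (f x) + length (concatMap f xs) ≤⟨ +-mono-≤ fx≤b (length-concatMap≤ f xs fxs≤b) ⟩
  _ + length xs * _                      ∎
  where open ≤-Reasoning

length-∄≡0 : ∀ (xs : List A) → (∀ {x} → x ∉ₗ xs) → length xs ≡ 0
length-∄≡0 [] _ = refl
length-∄≡0 (x ∷ xs) ∄ = contradiction (here refl) ∄

-- Vectors with a prescribed list of choices in each coordinate

choices : Vec (List A) n → List (Vec A n)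
choices [] = [] ∷ []
choices (xs ∷ xss) = cartesianProductWith _∷_ xs (choices xss)

numChoices : Vec (List A) n → ℕ
numChoices [] = 1
numChoices (xs ∷ xss) = length xs * numChoices xss

length-choices : (xss : Vec (List A) n) → length (choices xss) ≡ numChoices xss
length-choices [] = refl
length-choices (xs ∷ xss) =
  trans (length-cartesianProductWith _∷_ xs (choices xss)) (cong (length xs *_) (length-choices xss))

∈-choices⁺ : ∀ (xss : Vec (List A) n) {v} → (∀ i → lookup v i ∈ₗ lookup xss i) → v ∈ₗ choices xss
∈-choices⁺ [] {[]} _ = here refl
∈-choices⁺ (xs ∷ xss) {x ∷ v} v∈ = ∈-cartesianProductWith⁺ _∷_ (v∈ zero) (∈-choices⁺ xss (v∈ ∘ suc))

∈-choices⁻ : ∀ (xss : Vec (List A) n) {v} → v ∈ₗ choices xss → ∀ i → lookup v i ∈ₗ lookup xss i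
∈-choices⁻ (xs ∷ xss) v∈ i with ∈-cartesianProductWith⁻ _∷_ xs (choices xss) v∈
∈-choices⁻ (xs ∷ xss) v∈ zero    | x , w , x∈xs , w∈ , refl = x∈xs
∈-choices⁻ (xs ∷ xss) v∈ (suc i) | x , w , x∈xs , w∈ , refl = ∈-choices⁻ xss w∈ i

choices-unique : ∀ (xss : Vec (List A) n) → (∀ i → Unique (lookup xss i)) → Unique (choices xss)
choices-unique [] _ = All.[] ∷ []
choices-unique (xs ∷ xss) xss! =
  cartesianProductWith⁺ _∷_ ∷-injective (xss! zero) (choices-unique xss (λ i → xss! (suc i)))

allSubsets : ∀ n → List (Subset n)
allSubsets n = choices (replicate n (inside ∷ outside ∷ []))

∈-allSubsets : (p : Subset n) → p ∈ₗ allSubsets n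
∈-allSubsets {n} p = ∈-choices⁺ (replicate n _) λ i →
  subst (lookup p i ∈ₗ_) (sym (lookup-replicate i _)) (bit∈ (lookup p i))
  where
  bit∈ : ∀ b → b ∈ₗ inside ∷ outside ∷ []
  bit∈ true = here refl
  bit∈ false = there (here refl)

allSubsets-unique : ∀ n → Unique (allSubsets n)
allSubsets-unique n = choices-unique (replicate n _) λ i →
  subst Unique (sym (lookup-replicate i _)) (((λ ()) All.∷ All.[]) ∷ All.[] ∷ [])

∀-Subset? : {P : Subset n → Set} → Decidable P → Dec (∀ p → P p)
∀-Subset? {n} P? with All.all? P? (allSubsets n)
... | yes all = yes λ p → All.lookup all (∈-allSubsets p)
... | no ¬all = no λ all → ¬all (All.tabulate λ {p} _ → all p)

⊆∧∣⊇∣≤⇒⊇ : ∀ {p q : Subset n} → p ⊆ q → ∣ q ∣ ≤ ∣ p ∣ → q ⊆ p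
⊆∧∣⊇∣≤⇒⊇ {p = p} p⊆q ∣q∣≤∣p∣ {x} x∈q with x ∈? p
... | yes x∈p = x∈p
... | no x∉p = contradiction ∣q∣≤∣p∣ (<⇒≱ (p⊂q⇒∣p∣<∣q∣ (p⊆q , x , x∈q , x∉p)))

lookup≡false⇒∉ : ∀ {p : Subset n} {x} → lookup p x ≡ false → x ∉ p
lookup≡false⇒∉ p[x]≡false x∈p with trans (sym ([]=⇒lookup x∈p)) p[x]≡false
... | ()

∣x∷p∣≡∣[x]∣+∣p∣ : ∀ b (p : Subset n) → ∣ b ∷ p ∣ ≡ ∣ b ∷ [] ∣ + ∣ p ∣
∣x∷p∣≡∣[x]∣+∣p∣ true p = refl
∣x∷p∣≡∣[x]∣+∣p∣ false p = refl

-- Intersecting, maximal and extremal families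

module Families (R : Fin n → Fin n → Set) where

  intersecting-antimono : ∀ {F G} → F ⊆ G → Intersecting R G → Intersecting R F
  intersecting-antimono F⊆G iG x y x∈F y∈F x≢y = iG x y (F⊆G x∈F) (F⊆G y∈F) x≢y

  module Decision (R? : ∀ x y → Dec (R x y)) where

    intersecting? : Decidable (Intersecting R)
    intersecting? F = all? λ x → all? λ y → x ∈? F →-dec (y ∈? F →-dec (¬? (x ≟ y) →-dec R? x y))

    maximal? : Decidable (Maximal R)
    maximal? F = intersecting? F ×-dec ∀-Subset? λ G → intersecting? G →-dec (F ⊆? G →-dec G ⊆? F)

    extremal? : Decidable (Extremal R)
    extremal? F = intersecting? F ×-dec ∀-Subset? λ G → intersecting? G →-dec (∣ G ∣ ≤? ∣ F ∣)

    -- A largest intersecting superset of C is maximal.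
    extendToMaximal : ∀ {C} → Intersecting R C → Σ (Subset n) λ G → Maximal R G × C ⊆ G
    extendToMaximal {C} iC = G , (proj₂ G-ok , G-maximal) , proj₁ G-ok
      where
      Candidate : Subset n → Set
      Candidate G = C ⊆ G × Intersecting R G
      candidate? : Decidable Candidate
      candidate? G = C ⊆? G ×-dec intersecting? G
      candidates = filter candidate? (allSubsets n)
      G = argmax ∣_∣ C candidates
      G-ok : Candidate G
      G-ok = argmax-all ∣_∣ ((λ {_} → ⊆-refl) , iC) (all-filter candidate? (allSubsets n))
      G-maximal : ∀ H → Intersecting R H → G ⊆ H → H ⊆ G
      G-maximal H iH G⊆H = ⊆∧∣⊇∣≤⇒⊇ G⊆H (All.lookup (f[xs]≤f[argmax] C candidates)
        (∈-filter⁺ candidate? (∈-allSubsets H) (⊆-trans (proj₁ G-ok) G⊆H , iH)))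

    maximalFamilies : List (Subset n)
    maximalFamilies = filter maximal? (allSubsets n)

    ∈-maximalFamilies⁺ : ∀ {G} → Maximal R G → G ∈ₗ maximalFamilies
    ∈-maximalFamilies⁺ {G} = ∈-filter⁺ maximal? (∈-allSubsets G)

    ∈-maximalFamilies⁻ : ∀ {G} → G ∈ₗ maximalFamilies → Maximal R G
    ∈-maximalFamilies⁻ G∈ = proj₂ (∈-filter⁻ maximal? {xs = allSubsets n} G∈)

    length-maximalFamilies≤ : ∀ {M} → AtMost (Maximal R) M → length maximalFamilies ≤ M
    length-maximalFamilies≤ atMost = atMost maximalFamilies (filter⁺ maximal? (allSubsets-unique n))
      (all-filter maximal? (allSubsets n))

    maximal-overlap≤⊔ : ∀ {N₁ N₂} →
      (∀ F → Maximal R F → ¬ Extremal R F → ∣ F ∣ ≤ N₁) →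
      (∀ F G → Extremal R F → Extremal R G → F ≢ G → ∣ F ∩ G ∣ ≤ N₂) →
      ∀ {F G} → Maximal R F → Maximal R G → F ≢ G → ∣ F ∩ G ∣ ≤ N₁ ⊔ N₂
    maximal-overlap≤⊔ {N₁} {N₂} nonExtremal≤ extremalOverlap≤ {F} {G} mF mG F≢G
      with extremal? F | extremal? G
    ... | no ¬eF | _ = ≤-trans (∣p∩q∣≤∣p∣ F G) (≤-trans (nonExtremal≤ F mF ¬eF) (m≤m⊔n N₁ N₂))
    ... | yes _ | no ¬eG = ≤-trans (∣p∩q∣≤∣q∣ F G) (≤-trans (nonExtremal≤ G mG ¬eG) (m≤m⊔n N₁ N₂))
    ... | yes eF | yes eG = ≤-trans (extremalOverlap≤ F G eF eG F≢G) (m≤n⊔m N₁ N₂)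

-- Colourings compatible with a cover

one two : Fin 3
one = suc zero
two = suc (suc zero)

keepIf : Bool → A → List A → List A
keepIf true x xs = x ∷ xs
keepIf false x xs = xs

-- The colours allowed at a point lying in F (first flag) and in the covering families A, B, C.
-- Outside F only colour zero is allowed, matching the normalisation in IsColouring.
palette : Bool → Bool → Bool → Bool → List (Fin 3)
palette false _ _ _ = zero ∷ []
palette true a b c = keepIf a zero (keepIf b one (keepIf c two []))

palettes : (F A B C : Subset n) → Vec (List (Fin 3)) n
palettes F A B C = tabulate λ x → palette (lookup F x) (lookup A x) (lookup B x) (lookup C x)

compatible : (F A B C : Subset n) → List (Vec (Fin 3) n)
compatible F A B C = choices (palettes F A B C)

∈-compatible⁺ : ∀ (F A B C : Subset n) {c} →
  (∀ x → lookup c x ∈ₗ palette (lookup F x) (lookup A x) (lookup B x) (lookup C x)) →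
  c ∈ₗ compatible F A B C
∈-compatible⁺ F A B C {c} c∈ = ∈-choices⁺ (palettes F A B C) λ x →
  subst (lookup c x ∈ₗ_) (sym (lookup∘tabulate _ x)) (c∈ x)

∈-compatible⁻ : ∀ (F A B C : Subset n) {c} → c ∈ₗ compatible F A B C →
  ∀ x → lookup c x ∈ₗ palette (lookup F x) (lookup A x) (lookup B x) (lookup C x)
∈-compatible⁻ F A B C {c} c∈ x = subst (lookup c x ∈ₗ_) (lookup∘tabulate _ x) (∈-choices⁻ (palettes F A B C) c∈ x)

∈-palette⁺ : ∀ (g : Fin 3 → Bool) i → g i ≡ true → i ∈ₗ palette true (g zero) (g one) (g two)
∈-palette⁺ g zero gi rewrite gi = here refl
∈-palette⁺ g (suc zero) gi rewrite gi with g zero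
... | true = there (here refl)
... | false = here refl
∈-palette⁺ g (suc (suc zero)) gi rewrite gi with g zero | g one
... | true | true = there (there (here refl))
... | true | false = there (here refl)
... | false | true = there (here refl)
... | false | false = here refl

∈-palette-diag⁻ : ∀ {i} a → i ∈ₗ palette true a a a → a ≡ true
∈-palette-diag⁻ true _ = refl

palette-diag-unique : ∀ f → Unique (palette f f f f)
palette-diag-unique false = All.[] ∷ []
palette-diag-unique true = ((λ ()) All.∷ (λ ()) All.∷ All.[]) ∷ ((λ ()) All.∷ All.[]) ∷ All.[] ∷ []

compatible-diag-unique : (F : Subset n) → Unique (compatible F F F F)
compatible-diag-unique F = choices-unique (palettes F F F F) λ x →
  subst Unique (sym (lookup∘tabulate _ x)) (palette-diag-unique (lookup F x))

numChoices-palettes-diag : (F : Subset n) → numChoices (palettes F F F F) ≡ 3 ^ ∣ F ∣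
numChoices-palettes-diag [] = refl
numChoices-palettes-diag (true ∷ F) = cong (3 *_) (numChoices-palettes-diag F)
numChoices-palettes-diag (false ∷ F) = trans (+-identityʳ _) (numChoices-palettes-diag F)

compatible-diag⇒⊆ : ∀ (F A : Subset n) {c} → c ∈ₗ compatible F A A A → F ⊆ A
compatible-diag⇒⊆ F A c∈ {x} x∈F = lookup⇒[]= x A (∈-palette-diag⁻ (lookup A x)
  (subst (λ f → _ ∈ₗ palette f (lookup A x) (lookup A x) (lookup A x)) ([]=⇒lookup x∈F)
    (∈-compatible⁻ F A A A c∈ x)))

-- At a point lying in k ≤ 3 of the families there are at most k colours, and
-- k² · 8^[k = 3] ≤ 9^[k = 3] · 2^k.
palette-bound : ∀ f a b c →
  let l = length (palette f a b c)
      t = ∣ (a ∧ (b ∧ c)) ∷ [] ∣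
  in l * l * 8 ^ t ≤ 9 ^ t * 2 ^ (∣ a ∷ [] ∣ + ∣ b ∷ [] ∣ + ∣ c ∷ [] ∣)
palette-bound false false false false = ≤ᵇ⇒≤ _ _ _
palette-bound false false false true  = ≤ᵇ⇒≤ _ _ _
palette-bound false false true  false = ≤ᵇ⇒≤ _ _ _
palette-bound false false true  true  = ≤ᵇ⇒≤ _ _ _
palette-bound false true  false false = ≤ᵇ⇒≤ _ _ _
palette-bound false true  false true  = ≤ᵇ⇒≤ _ _ _
palette-bound false true  true  false = ≤ᵇ⇒≤ _ _ _
palette-bound false true  true  true  = ≤ᵇ⇒≤ _ _ _
palette-bound true  false false false = ≤ᵇ⇒≤ _ _ _
palette-bound true  false false true  = ≤ᵇ⇒≤ _ _ _
palette-bound true  false true  false = ≤ᵇ⇒≤ _ _ _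
palette-bound true  false true  true  = ≤ᵇ⇒≤ _ _ _
palette-bound true  true  false false = ≤ᵇ⇒≤ _ _ _
palette-bound true  true  false true  = ≤ᵇ⇒≤ _ _ _
palette-bound true  true  true  false = ≤ᵇ⇒≤ _ _ _
palette-bound true  true  true  true  = ≤ᵇ⇒≤ _ _ _

numChoices-palettes-bound : ∀ (F A B C : Subset n) →
  let P = numChoices (palettes F A B C) in
  P * P * 8 ^ ∣ A ∩ B ∩ C ∣ ≤ 9 ^ ∣ A ∩ B ∩ C ∣ * 2 ^ (∣ A ∣ + ∣ B ∣ + ∣ C ∣)
numChoices-palettes-bound [] [] [] [] = ≤-refl
numChoices-palettes-bound (f ∷ F) (a ∷ A) (b ∷ B) (c ∷ C) = begin
  (l * P) * (l * P) * 8 ^ ∣ t ∷ I ∣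
    ≡⟨ cong (λ k → (l * P) * (l * P) * 8 ^ k) (∣x∷p∣≡∣[x]∣+∣p∣ t I) ⟩
  (l * P) * (l * P) * 8 ^ (∣ t ∷ [] ∣ + ∣ I ∣)
    ≡⟨ cong ((l * P) * (l * P) *_) (^-distribˡ-+-* 8 ∣ t ∷ [] ∣ ∣ I ∣) ⟩
  (l * P) * (l * P) * (8 ^ ∣ t ∷ [] ∣ * 8 ^ ∣ I ∣)
    ≡⟨ interchange l P (8 ^ ∣ t ∷ [] ∣) (8 ^ ∣ I ∣) ⟩
  (l * l * 8 ^ ∣ t ∷ [] ∣) * (P * P * 8 ^ ∣ I ∣)
    ≤⟨ *-mono-≤ (palette-bound f a b c) (numChoices-palettes-bound F A B C) ⟩
  (9 ^ ∣ t ∷ [] ∣ * 2 ^ e) * (9 ^ ∣ I ∣ * 2 ^ E)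
    ≡⟨ [m*n]*[o*p]≡[m*o]*[n*p] (9 ^ ∣ t ∷ [] ∣) (2 ^ e) (9 ^ ∣ I ∣) (2 ^ E) ⟩
  (9 ^ ∣ t ∷ [] ∣ * 9 ^ ∣ I ∣) * (2 ^ e * 2 ^ E)
    ≡⟨ cong₂ _*_ (^-distribˡ-+-* 9 ∣ t ∷ [] ∣ ∣ I ∣) (^-distribˡ-+-* 2 e E) ⟨
  9 ^ (∣ t ∷ [] ∣ + ∣ I ∣) * 2 ^ (e + E)
    ≡⟨ cong₂ (λ k m → 9 ^ k * 2 ^ m) (∣x∷p∣≡∣[x]∣+∣p∣ t I) cardinalities ⟨
  9 ^ ∣ t ∷ I ∣ * 2 ^ (∣ a ∷ A ∣ + ∣ b ∷ B ∣ + ∣ c ∷ C ∣)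
    ∎
  where
  open ≤-Reasoning
  l = length (palette f a b c)
  P = numChoices (palettes F A B C)
  t = a ∧ (b ∧ c)
  I = A ∩ B ∩ C
  e = ∣ a ∷ [] ∣ + ∣ b ∷ [] ∣ + ∣ c ∷ [] ∣
  E = ∣ A ∣ + ∣ B ∣ + ∣ C ∣
  interchange : ∀ l P x y → (l * P) * (l * P) * (x * y) ≡ (l * l * x) * (P * P * y)
  interchange = solve-∀
  regroup : ∀ a A b B c C → (a + A) + (b + B) + (c + C) ≡ (a + b + c) + (A + B + C)
  regroup = solve-∀
  cardinalities : ∣ a ∷ A ∣ + ∣ b ∷ B ∣ + ∣ c ∷ C ∣ ≡ e + E
  cardinalities = trans (cong₂ (λ u v → u + v + ∣ c ∷ C ∣) (∣x∷p∣≡∣[x]∣+∣p∣ a A) (∣x∷p∣≡∣[x]∣+∣p∣ b B))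
    (trans (cong (_ +_) (∣x∷p∣≡∣[x]∣+∣p∣ c C)) (regroup (∣ a ∷ [] ∣) (∣ A ∣) (∣ b ∷ [] ∣) (∣ B ∣) (∣ c ∷ [] ∣) (∣ C ∣)))

module Colourings (R : Fin n → Fin n → Set) where

  open Families R

  colourClass⊆ : ∀ F c i → colourClass R F c i ⊆ F
  colourClass⊆ F c i = p∩q⊆p F _

  ∈-colourClass : ∀ {F x} c → x ∈ F → x ∈ colourClass R F c (lookup c x)
  ∈-colourClass {x = x} c x∈F = x∈p∩q⁺ (x∈F , lookup⇒[]= x _
    (trans (lookup∘tabulate _ x) (dec-true (lookup c x ≟ lookup c x) refl)))

  colouring∈compatible : ∀ {F c} → IsColouring R F c →
    (G : Fin 3 → Subset n) → (∀ i → colourClass R F c i ⊆ G i) →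
    c ∈ₗ compatible F (G zero) (G one) (G two)
  colouring∈compatible {F} {c} (outside⇒zero , _) G class⊆G = ∈-compatible⁺ F (G zero) (G one) (G two) allowed
    where
    allowed : ∀ x → lookup c x ∈ₗ palette (lookup F x) (lookup (G zero) x) (lookup (G one) x) (lookup (G two) x)
    allowed x with lookup F x in F[x]
    ... | false = here (outside⇒zero x (lookup≡false⇒∉ F[x]))
    ... | true = ∈-palette⁺ (λ i → lookup (G i) x) (lookup c x)
      ([]=⇒lookup (class⊆G (lookup c x) (∈-colourClass c (lookup⇒[]= x F F[x]))))

  compatible-diag⇒colouring : ∀ {F c} → Intersecting R F → c ∈ₗ compatible F F F F → IsColouring R F c
  compatible-diag⇒colouring {F} {c} iF c∈ = outside⇒zero , λ i → intersecting-antimono (colourClass⊆ F c i) iF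
    where
    outside⇒zero : ∀ x → x ∉ F → lookup c x ≡ zero
    outside⇒zero x x∉F with lookup F x in F[x] | ∈-compatible⁻ F F F F c∈ x
    ... | true | _ = contradiction (lookup⇒[]= x F F[x]) x∉F
    ... | false | here c[x]≡zero = c[x]≡zero

  length-compatible-diag : (F : Subset n) → length (compatible F F F F) ≡ 3 ^ ∣ F ∣
  length-compatible-diag F = trans (length-choices (palettes F F F F)) (numChoices-palettes-diag F)

  colourings≤3^∣F∣ : ∀ F → AtMost (IsColouring R F) (3 ^ ∣ F ∣)
  colourings≤3^∣F∣ F L L! colourings = subst (length L ≤_) (length-compatible-diag F)
    (Unique∧⊆⇒length≤ L! λ {c} c∈L →
      colouring∈compatible (All.lookup colourings c∈L) (λ _ → F) (colourClass⊆ F c))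

  intersecting⇒colourings≥3^∣F∣ : ∀ {F} → Intersecting R F → AtLeast (IsColouring R F) (3 ^ ∣ F ∣)
  intersecting⇒colourings≥3^∣F∣ {F} iF = compatible F F F F , compatible-diag-unique F ,
    All.tabulate (compatible-diag⇒colouring iF) , ≤-reflexive (sym (length-compatible-diag F))

8^≤9^-exponent-mono : ∀ {I K x y} → I ≤ K → x * 8 ^ I ≤ 9 ^ I * y → x * 8 ^ K ≤ 9 ^ K * y
8^≤9^-exponent-mono {I} {K} {x} {y} I≤K bound = begin
  x * 8 ^ K               ≡⟨ cong (λ k → x * 8 ^ k) (m+[n∸m]≡n I≤K) ⟨
  x * 8 ^ (I + j)         ≡⟨ cong (x *_) (^-distribˡ-+-* 8 I j) ⟩
  x * (8 ^ I * 8 ^ j)     ≡⟨ *-assoc x (8 ^ I) (8 ^ j) ⟨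
  x * 8 ^ I * 8 ^ j       ≤⟨ *-mono-≤ bound (^-monoˡ-≤ j (≤ᵇ⇒≤ 8 9 _)) ⟩
  9 ^ I * y * 9 ^ j       ≡⟨ swap (9 ^ I) y (9 ^ j) ⟩
  9 ^ I * 9 ^ j * y       ≡⟨ cong (_* y) (^-distribˡ-+-* 9 I j) ⟨
  9 ^ (I + j) * y         ≡⟨ cong (λ k → 9 ^ k * y) (m+[n∸m]≡n I≤K) ⟩
  9 ^ K * y               ∎
  where
  open ≤-Reasoning
  j = K ∸ I
  swap : ∀ a b c → a * b * c ≡ a * c * b
  swap = solve-∀

2^[a+b+c]≤8^ : ∀ {a b c N} → a ≤ N → b ≤ N → c ≤ N → 2 ^ (a + b + c) ≤ 8 ^ N
2^[a+b+c]≤8^ {a} {b} {c} {N} a≤N b≤N c≤N = begin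
  2 ^ (a + b + c)   ≤⟨ ^-monoʳ-≤ 2 (+-mono-≤ (+-mono-≤ a≤N b≤N) c≤N) ⟩
  2 ^ (N + N + N)   ≡⟨ cong (2 ^_) (thrice N) ⟩
  2 ^ (3 * N)       ≡⟨ ^-*-assoc 2 3 N ⟨
  8 ^ N             ∎
  where
  open ≤-Reasoning
  thrice : ∀ N → N + N + N ≡ 3 * N
  thrice = solve-∀

cube-square-bound : ∀ {T m B M z X} → T ≤ m * (m * m) * B → m ≤ M → B * B * z ≤ X → T * T * z ≤ M ^ 6 * X
cube-square-bound {T} {m} {B} {M} {z} {X} T≤ m≤M B²z≤X = begin
  T * T * z                               ≤⟨ *-monoˡ-≤ z (*-mono-≤ T≤ T≤) ⟩
  m * (m * m) * B * (m * (m * m) * B) * z ≡⟨ regroup m B z ⟩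
  m ^ 6 * (B * B * z)                     ≤⟨ *-mono-≤ (^-monoˡ-≤ 6 m≤M) B²z≤X ⟩
  M ^ 6 * X                               ∎
  where
  open ≤-Reasoning
  regroup : ∀ m B z → m * (m * m) * B * (m * (m * m) * B) * z ≡ m * (m * (m * (m * (m * (m * 1))))) * (B * B * z)
  regroup = solve-∀

9^≡3^*3^ : ∀ N → 9 ^ N ≡ 3 ^ N * 3 ^ N
9^≡3^*3^ N = begin
  9 ^ N             ≡⟨ ^-*-assoc 3 2 N ⟩
  3 ^ (2 * N)       ≡⟨ cong (3 ^_) (twice N) ⟩
  3 ^ (N + N)       ≡⟨ ^-distribˡ-+-* 3 N N ⟩
  3 ^ N * 3 ^ N     ∎
  where
  open ≡-Reasoning
  twice : ∀ N → 2 * N ≡ N + N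
  twice = solve-∀

3^-cancel-≤ : ∀ {a b} → 3 ^ a ≤ 3 ^ b → a ≤ b
3^-cancel-≤ 3^a≤3^b = ≮⇒≥ λ b<a → <⇒≱ (^-monoʳ-< 3 (≤ᵇ⇒≤ 2 3 _) b<a) 3^a≤3^b

square-bound⇒<3^ : ∀ {T K N M} → K ≤ N → T * T * 8 ^ K ≤ M ^ 6 * (9 ^ K * 8 ^ N) →
  8 ^ (N ∸ K) * M ^ 6 < 9 ^ (N ∸ K) → T < 3 ^ N
square-bound⇒<3^ {T} {K} {N} {M} K≤N T²-bound ratio = ≰⇒> λ 3^N≤T →
  <⇒≱ ratio (*-cancelʳ-≤ (9 ^ d) (8 ^ d * M ^ 6) (9 ^ K * 8 ^ K) {{>-nonZero 9^K*8^K>0}} (begin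
    9 ^ d * (9 ^ K * 8 ^ K)           ≡⟨ *-assoc (9 ^ d) (9 ^ K) (8 ^ K) ⟨
    9 ^ d * 9 ^ K * 8 ^ K             ≡⟨ cong (_* 8 ^ K) (trans (cong (9 ^_) (sym d+K≡N)) (^-distribˡ-+-* 9 d K)) ⟨
    9 ^ N * 8 ^ K                     ≡⟨ cong (_* 8 ^ K) (9^≡3^*3^ N) ⟩
    3 ^ N * 3 ^ N * 8 ^ K             ≤⟨ *-monoˡ-≤ (8 ^ K) (*-mono-≤ 3^N≤T 3^N≤T) ⟩
    T * T * 8 ^ K                     ≤⟨ T²-bound ⟩
    M ^ 6 * (9 ^ K * 8 ^ N)           ≡⟨ cong (λ k → M ^ 6 * (9 ^ K * 8 ^ k)) d+K≡N ⟨
    M ^ 6 * (9 ^ K * 8 ^ (d + K))     ≡⟨ cong (λ e → M ^ 6 * (9 ^ K * e)) (^-distribˡ-+-* 8 d K) ⟩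
    M ^ 6 * (9 ^ K * (8 ^ d * 8 ^ K)) ≡⟨ regroup (M ^ 6) (9 ^ K) (8 ^ d) (8 ^ K) ⟩
    8 ^ d * M ^ 6 * (9 ^ K * 8 ^ K)   ∎))
  where
  open ≤-Reasoning
  d = N ∸ K
  d+K≡N : d + K ≡ N
  d+K≡N = m∸n+n≡m K≤N
  9^K*8^K>0 : 0 < 9 ^ K * 8 ^ K
  9^K*8^K>0 = *-mono-< (m^n>0 9 K) (m^n>0 8 K)
  regroup : ∀ m a b c → m * (a * (b * c)) ≡ b * m * (a * c)
  regroup = solve-∀

-- Colourings of a non-intersecting family

module NonIntersecting (R : Fin n → Fin n → Set) (R? : ∀ x y → Dec (R x y)) {N₀ K : ℕ}
  (intersecting-size≤ : ∀ {G} → Intersecting R G → ∣ G ∣ ≤ N₀)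
  (maximal-overlap≤ : ∀ {A B} → Maximal R A → Maximal R B → A ≢ B → ∣ A ∩ B ∣ ≤ K)
  where

  open Families R
  open Decision R?
  open Colourings R

  Cover : Set
  Cover = Subset n × Subset n × Subset n

  maximalCovers : List Cover
  maximalCovers = cartesianProduct maximalFamilies (cartesianProduct maximalFamilies maximalFamilies)

  length-maximalCovers : length maximalCovers ≡ length maximalFamilies * (length maximalFamilies * length maximalFamilies)
  length-maximalCovers = trans (length-cartesianProductWith _,_ maximalFamilies _)
    (cong (length maximalFamilies *_) (length-cartesianProductWith _,_ maximalFamilies maximalFamilies))

  compatibleWith : Subset n → Cover → List (Vec (Fin 3) n)
  compatibleWith F (A , B , C) = compatible F A B C

  overlap-bound : ∀ F {A B C} → Maximal R A → Maximal R B → Maximal R C → ∣ A ∩ B ∩ C ∣ ≤ K →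
    let P = length (compatible F A B C) in P * P * 8 ^ K ≤ 9 ^ K * 8 ^ N₀
  overlap-bound F {A} {B} {C} mA mB mC I≤K = 8^≤9^-exponent-mono {x = P * P} I≤K (begin
    P * P * 8 ^ I                      ≡⟨ cong (λ k → k * k * 8 ^ I) (length-choices (palettes F A B C)) ⟩
    P′ * P′ * 8 ^ I                    ≤⟨ numChoices-palettes-bound F A B C ⟩
    9 ^ I * 2 ^ (∣ A ∣ + ∣ B ∣ + ∣ C ∣)   ≤⟨ *-monoʳ-≤ (9 ^ I) (2^[a+b+c]≤8^ (size mA) (size mB) (size mC)) ⟩
    9 ^ I * 8 ^ N₀                     ∎)
    where
    open ≤-Reasoning
    I = ∣ A ∩ B ∩ C ∣
    P = length (compatible F A B C)
    P′ = numChoices (palettes F A B C)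
    size : ∀ {G} → Maximal R G → ∣ G ∣ ≤ N₀
    size = intersecting-size≤ ∘ proj₁

  diagonal-empty : ∀ {F A} → ¬ Intersecting R F → Maximal R A → length (compatible F A A A) ≡ 0
  diagonal-empty {F} {A} ¬iF mA = length-∄≡0 _ λ c∈ →
    ¬iF (intersecting-antimono (compatible-diag⇒⊆ F A c∈) (proj₁ mA))

  cover-bound : ∀ {F} → ¬ Intersecting R F → ∀ {A B C} → Maximal R A → Maximal R B → Maximal R C →
    let P = length (compatible F A B C) in P * P * 8 ^ K ≤ 9 ^ K * 8 ^ N₀
  cover-bound {F} ¬iF {A} {B} {C} mA mB mC with ≡-dec _≟ᵇ_ A B | ≡-dec _≟ᵇ_ B C
  ... | no A≢B | _ = overlap-bound F mA mB mC (≤-trans (p⊆q⇒∣p∣≤∣q∣ A∩B∩C⊆A∩B) (maximal-overlap≤ mA mB A≢B))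
    where
    A∩B∩C⊆A∩B : A ∩ B ∩ C ⊆ A ∩ B
    A∩B∩C⊆A∩B x∈ = let x∈A , x∈B∩C = x∈p∩q⁻ A _ x∈ in x∈p∩q⁺ (x∈A , proj₁ (x∈p∩q⁻ B C x∈B∩C))
  ... | yes refl | no B≢C = overlap-bound F mA mB mC (≤-trans (∣p∩q∣≤∣q∣ A (B ∩ C)) (maximal-overlap≤ mB mC B≢C))
  ... | yes refl | yes refl rewrite diagonal-empty ¬iF mA = z≤n

  colouring∈maximalCovers : ∀ {F c} → IsColouring R F c → c ∈ₗ concatMap (compatibleWith F) maximalCovers
  colouring∈maximalCovers {F} {c} col = ∈-concatMap⁺ (compatibleWith F) (lose cover∈ (colouring∈compatible col G class⊆G))
    where
    extension : ∀ i → Σ (Subset n) λ G → Maximal R G × colourClass R F c i ⊆ G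
    extension i = extendToMaximal (proj₂ col i)
    G : Fin 3 → Subset n
    G i = proj₁ (extension i)
    class⊆G : ∀ i → colourClass R F c i ⊆ G i
    class⊆G i = proj₂ (proj₂ (extension i))
    G∈ : ∀ i → G i ∈ₗ maximalFamilies
    G∈ i = ∈-maximalFamilies⁺ (proj₁ (proj₂ (extension i)))
    cover∈ : (G zero , G one , G two) ∈ₗ maximalCovers
    cover∈ = ∈-cartesianProduct⁺ (G∈ zero) (∈-cartesianProduct⁺ (G∈ one) (G∈ two))

  colourings-square-bound : ∀ {F M} → ¬ Intersecting R F → AtMost (Maximal R) M →
    ∀ L → Unique L → All (IsColouring R F) L → length L * length L * 8 ^ K ≤ M ^ 6 * (9 ^ K * 8 ^ N₀)
  colourings-square-bound {F} ¬iF atMost L L! colourings =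
    cube-square-bound T≤ (length-maximalFamilies≤ atMost) (argmax-all id {P = Bounded} z≤n (map⁺ (All.tabulate bounded)))
    where
    Bounded : ℕ → Set
    Bounded P = P * P * 8 ^ K ≤ 9 ^ K * 8 ^ N₀
    counts = map (length ∘ compatibleWith F) maximalCovers
    largest = max 0 counts
    m = length maximalFamilies
    bounded : ∀ {t} → t ∈ₗ maximalCovers → Bounded (length (compatibleWith F t))
    bounded {A , B , C} t∈ =
      let A∈ , BC∈ = ∈-cartesianProduct⁻ maximalFamilies _ t∈
          B∈ , C∈ = ∈-cartesianProduct⁻ maximalFamilies maximalFamilies BC∈
      in cover-bound ¬iF (∈-maximalFamilies⁻ A∈) (∈-maximalFamilies⁻ B∈) (∈-maximalFamilies⁻ C∈)
    T≤ : length L ≤ m * (m * m) * largest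
    T≤ = begin
      length L                                            ≤⟨ Unique∧⊆⇒length≤ L! (colouring∈maximalCovers ∘ All.lookup colourings) ⟩
      length (concatMap (compatibleWith F) maximalCovers) ≤⟨ length-concatMap≤ (compatibleWith F) maximalCovers
                                                               (map⁻ (xs≤max 0 counts)) ⟩
      length maximalCovers * largest                      ≡⟨ cong (_* largest) length-maximalCovers ⟩
      m * (m * m) * largest                               ∎
      where open ≤-Reasoning

  colourings<3^N₀ : ∀ {M} → K ≤ N₀ → 8 ^ (N₀ ∸ K) * M ^ 6 < 9 ^ (N₀ ∸ K) → AtMost (Maximal R) M →
    ∀ {F} → ¬ Intersecting R F → ∀ L → Unique L → All (IsColouring R F) L → length L < 3 ^ N₀
  colourings<3^N₀ {M} K≤N₀ ratio atMost ¬iF L L! colourings =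
    square-bound⇒<3^ {M = M} K≤N₀ (colourings-square-bound ¬iF atMost L L! colourings) ratio

module Characterisation (R : Fin n → Fin n → Set) (R? : ∀ x y → Dec (R x y)) {N₀ : ℕ}
  (intersecting-size≤ : ∀ {G} → Intersecting R G → ∣ G ∣ ≤ N₀)
  (size-attained : Σ (Subset n) λ E → Intersecting R E × N₀ ≤ ∣ E ∣)
  (nonIntersecting-colourings< : ∀ {F} → ¬ Intersecting R F →
    ∀ L → Unique L → All (IsColouring R F) L → length L < 3 ^ N₀)
  where

  open Families.Decision R R?
  open Colourings R

  colourings≤3^N₀ : ∀ F → AtMost (IsColouring R F) (3 ^ N₀)
  colourings≤3^N₀ F L L! colourings with intersecting? F
  ... | yes iF = ≤-trans (colourings≤3^∣F∣ F L L! colourings) (^-monoʳ-≤ 3 (intersecting-size≤ iF))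
  ... | no ¬iF = <⇒≤ (nonIntersecting-colourings< ¬iF L L! colourings)

  colourings≥3^N₀⇒extremal : ∀ {F} → AtLeast (IsColouring R F) (3 ^ N₀) → Extremal R F
  colourings≥3^N₀⇒extremal {F} (L , L! , colourings , 3^N₀≤) with intersecting? F
  ... | no ¬iF = contradiction 3^N₀≤ (<⇒≱ (nonIntersecting-colourings< ¬iF L L! colourings))
  ... | yes iF = iF , λ G iG → ≤-trans (intersecting-size≤ iG)
    (3^-cancel-≤ (≤-trans 3^N₀≤ (colourings≤3^∣F∣ F L L! colourings)))

  extremal⇒colourings≥3^N₀ : ∀ {F} → Extremal R F → AtLeast (IsColouring R F) (3 ^ N₀)
  extremal⇒colourings≥3^N₀ {F} (iF , F-largest) = subst (λ k → AtLeast (IsColouring R F) (3 ^ k))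
    (≤-antisym (intersecting-size≤ iF) N₀≤∣F∣) (intersecting⇒colourings≥3^∣F∣ iF)
    where
    N₀≤∣F∣ : N₀ ≤ ∣ F ∣
    N₀≤∣F∣ = let E , iE , N₀≤∣E∣ = size-attained in ≤-trans N₀≤∣E∣ (F-largest E iE)

theorem1p2 : (n : ℕ) (R : Fin n → Fin n → Set)
    → (∀ x y → Dec (R x y))
    → (∀ x y → R x y → R y x)
    → (N₀ N₁ N₂ M : ℕ)
    → Σ (Subset n) (λ F → Extremal R F × ∣ F ∣ ≡ N₀)
    → (∀ F → Maximal R F → ¬ Extremal R F → ∣ F ∣ ≤ N₁)
    → (N₁ ≡ 0 ⊎ Σ (Subset n) (λ F → Maximal R F × ¬ Extremal R F × ∣ F ∣ ≡ N₁))
    → (∀ F G → Extremal R F → Extremal R G → F ≢ G → ∣ F ∩ G ∣ ≤ N₂)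
    → AtMost (Maximal R) M
    → (N₁ ⊔ N₂ < N₀)
    → (8 ^ (N₀ ∸ (N₁ ⊔ N₂)) * M ^ 6 < 9 ^ (N₀ ∸ (N₁ ⊔ N₂)))
    → (F : Subset n)
    → AtMost (IsColouring R F) (3 ^ N₀)
    × (AtLeast (IsColouring R F) (3 ^ N₀) ⇔ Extremal R F)
theorem1p2 n R R? _ N₀ N₁ N₂ M (E , (iE , E-largest) , ∣E∣≡N₀) nonExtremal≤ _ extremalOverlap≤ maximalCount
  K<N₀ ratio F = colourings≤3^N₀ F , mk⇔ colourings≥3^N₀⇒extremal extremal⇒colourings≥3^N₀
  where
  intersecting-size≤ : ∀ {G} → Intersecting R G → ∣ G ∣ ≤ N₀
  intersecting-size≤ {G} iG = subst (∣ G ∣ ≤_) ∣E∣≡N₀ (E-largest G iG)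
  open Families.Decision R R? using (maximal-overlap≤⊔)
  open NonIntersecting R R? intersecting-size≤ (maximal-overlap≤⊔ nonExtremal≤ extremalOverlap≤)
  open Characterisation R R? intersecting-size≤ (E , iE , ≤-reflexive (sym ∣E∣≡N₀))
    (colourings<3^N₀ (<⇒≤ K<N₀) ratio maximalCount)
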